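{- Let $(P,\leq,{}',0,1)$ be an orthogonal lub-complete poset and $x,y\in P$. Then: (i) if $x\leq y$ then $x\rightarrow_K y=\{x\vee y'\vee a: a\in\operatorname{Max}L(x',y)\}$; if $x\perp y$ then $x\rightarrow_K y=\{y\vee b: b\in\operatorname{Max}L(x',y')\}$; if $y\leq x$ then $x\rightarrow_K y=\{x'\vee(x\wedge c): c\in\operatorname{Min}U(x',y)\}$; (ii) $x\rightarrow_K 1=\{x\vee x'\}$ and $1\rightarrow_K x=\{x\}$; (iii) $x\rightarrow_K 0=\{x'\}$ and $0\rightarrow_K x=\{x\vee x'\}$.
   Context: For a poset $(P,\leq)$ and $A\subseteq P$: $L(A)=\{x: x\leq a\ \forall a\in A\}$, $U(A)=\{x: a\leq x\ \forall a\in A\}$, $L(x,y)=L(\{x,y\})$, $U(x,y)=U(\{x,y\})$; $\operatorname{Max}A$, $\operatorname{Min}A$: maximal/minimal elements of $A$. $x\vee y$, $x\wedge y$: supremum/infimum. A bounded poset $(P,\leq,{}',0,1)$ with antitone involution: $x\leq y\Rightarrow y'\leq x'$, $x''=x$. $x\perp y$ iff $x\leq y'$. Orthogonal: $x\perp y$ implies $x\vee y$ exists. Lub-complete: for every finite $M\subseteq P$ and lower bound $x$ of $M$ there is a maximal element of $L(M)$ above $x$. Kalmbach implication: $x\rightarrow_K y=\{(a\vee b)\vee(x\wedge c): a\in\operatorname{Max}L(x',y), b\in\operatorname{Max}L(x',y'), c\in\operatorname{Min}U(x',y)\}$ (all these suprema and infima exist in an orthogonal lub-complete poset). -}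

module Defs where

open import Level using (Level; _⊔_; suc)
open import Data.Product using (Σ; ∃; _×_; _,_)
open import Data.List using (List; []; _∷_)
open import Data.List.Relation.Unary.All using (All)
open import Relation.Unary using (Pred; _≐_)
open import Relation.Binary.Bundles using (Poset)

record BoundedPosetInv (c ℓ₁ ℓ₂ : Level) : Set (suc (c ⊔ ℓ₁ ⊔ ℓ₂)) where
  field
    poset : Poset c ℓ₁ ℓ₂
  open Poset poset public
  field
    _′       : Carrier → Carrier
    ⊥        : Carrier
    ⊤        : Carrier
    ⊥-min    : ∀ x → ⊥ ≤ x
    ⊤-max    : ∀ x → x ≤ ⊤
    antitone : ∀ {x y} → x ≤ y → y ′ ≤ x ′
    involutive : ∀ x → (x ′) ′ ≈ x

module Ops {c ℓ₁ ℓ₂ : Level} (P : BoundedPosetInv c ℓ₁ ℓ₂) where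
  open BoundedPosetInv P

  ℓ : Level
  ℓ = c ⊔ ℓ₁ ⊔ ℓ₂

  Subset : Set (c ⊔ Level.suc ℓ)
  Subset = Pred Carrier ℓ

  L : List Carrier → Subset
  L M z = Level.Lift ℓ (All (λ m → z ≤ m) M)

  U : List Carrier → Subset
  U M z = Level.Lift ℓ (All (λ m → m ≤ z) M)

  L₂ : Carrier → Carrier → Subset
  L₂ x y = L (x ∷ y ∷ [])

  U₂ : Carrier → Carrier → Subset
  U₂ x y = U (x ∷ y ∷ [])

  Max : Subset → Subset
  Max A z = A z × (∀ w → A w → z ≤ w → w ≈ z)

  Min : Subset → Subset
  Min A z = A z × (∀ w → A w → w ≤ z → w ≈ z)

  IsSup : Carrier → Carrier → Carrier → Set ℓ
  IsSup s x y = Level.Lift ℓ₁ ((x ≤ s × y ≤ s) × (∀ u → x ≤ u → y ≤ u → s ≤ u))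

  IsInf : Carrier → Carrier → Carrier → Set ℓ
  IsInf i x y = Level.Lift ℓ₁ ((i ≤ x × i ≤ y) × (∀ u → u ≤ x → u ≤ y → u ≤ i))

  _⊥⊥_ : Carrier → Carrier → Set ℓ₂
  x ⊥⊥ y = x ≤ y ′

  Orthogonal : Set ℓ
  Orthogonal = ∀ x y → x ⊥⊥ y → ∃ λ s → IsSup s x y

  LubComplete : Set ℓ
  LubComplete = ∀ (M : List Carrier) x → L M x → ∃ λ m → Max (L M) m × x ≤ m

  ⟦_⟧ : Carrier → Subset
  ⟦ a ⟧ z = Level.Lift ℓ (z ≈ a)

  -- Kalmbach implication
  -- x →K y = {(a ∨ b) ∨ (x ∧ c) : a ∈ Max L(x′,y), b ∈ Max L(x′,y′), c ∈ Min U(x′,y)}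
  _→K_ : Carrier → Carrier → Subset
  (x →K y) z =
    Σ Carrier λ a → Σ Carrier λ b → Σ Carrier λ c → Σ Carrier λ d → Σ Carrier λ e →
      Max (L₂ (x ′) y) a × Max (L₂ (x ′) (y ′)) b × Min (U₂ (x ′) y) c ×
      IsSup d a b × IsInf e x c × IsSup z d e

-- An element of x →K y is the join of three elements: a ∈ Max L(x′,y),
-- b ∈ Max L(x′,y′) and x ∧ c with c ∈ Min U(x′,y); a threefold join does not
-- depend on how it is bracketed or ordered. In each special case, comparability
-- pins some of a, b, c down (a maximal lower bound of a comparable pair is the
-- smaller element, a minimal upper bound the larger one), and the remaining
-- joinand is absorbed because it lies below another one. For x ⊥ y the
-- absorption of x ∧ x′ by b uses orthogonality: b ∨ (x ∧ x′) is again a lower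
-- bound of x′ and y′, so it equals b by maximality.
module Submission where

open import Defs
open import Level using (Level; lift; _⊔_)
open import Data.Product using (Σ; _×_; _,_; proj₁; map; map₂)
open import Data.List using ([]; _∷_)
open import Data.List.Relation.Unary.All using ([]; _∷_)
open import Relation.Unary using (_≐_)

module Kalmbach {c ℓ₁ ℓ₂ : Level} (P : BoundedPosetInv c ℓ₁ ℓ₂) where
  open BoundedPosetInv P
  open Ops P

  private variable
    b d e m p p′ q q′ r r′ s s′ x y z : Carrier

  ′-cong : p ≈ q → p ′ ≈ q ′
  ′-cong p≈q = antisym (antitone (reflexive (Eq.sym p≈q))) (antitone (reflexive p≈q))

  ⊥⊥-sym : p ⊥⊥ q → q ⊥⊥ p
  ⊥⊥-sym p≤q′ = ≤-respˡ-≈ (involutive _) (antitone p≤q′)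

  ′≤-sym : p ′ ≤ q → q ′ ≤ p
  ′≤-sym p′≤q = ≤-respʳ-≈ (involutive _) (antitone p′≤q)

  ≤⇒⊥⊥′ : p ≤ q → p ⊥⊥ (q ′)
  ≤⇒⊥⊥′ {q = q} p≤q = ≤-respʳ-≈ (Eq.sym (involutive q)) p≤q

  ⊤′-min : ∀ p → ⊤ ′ ≤ p
  ⊤′-min p = ′≤-sym (⊤-max (p ′))

  ⊥′-max : ∀ p → p ≤ ⊥ ′
  ⊥′-max p = ⊥⊥-sym (⊥-min (p ′))

  L₂-intro : z ≤ p → z ≤ q → L₂ p q z
  L₂-intro z≤p z≤q = lift (z≤p ∷ z≤q ∷ [])

  L₂-≤ˡ : L₂ p q z → z ≤ p
  L₂-≤ˡ (lift (z≤p ∷ _)) = z≤p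

  L₂-≤ʳ : L₂ p q z → z ≤ q
  L₂-≤ʳ (lift (_ ∷ z≤q ∷ [])) = z≤q

  U₂-intro : p ≤ z → q ≤ z → U₂ p q z
  U₂-intro p≤z q≤z = lift (p≤z ∷ q≤z ∷ [])

  U₂-≥ˡ : U₂ p q z → p ≤ z
  U₂-≥ˡ (lift (p≤z ∷ _)) = p≤z

  U₂-≥ʳ : U₂ p q z → q ≤ z
  U₂-≥ʳ (lift (_ ∷ q≤z ∷ [])) = q≤z

  Max-L₂ˡ : p ≤ q → Max (L₂ p q) p
  Max-L₂ˡ p≤q = L₂-intro refl p≤q , λ w w∈L p≤w → antisym (L₂-≤ˡ w∈L) p≤w

  Max-L₂ʳ : q ≤ p → Max (L₂ p q) q
  Max-L₂ʳ q≤p = L₂-intro q≤p refl , λ w w∈L q≤w → antisym (L₂-≤ʳ w∈L) q≤w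

  Max-L₂ˡ-unique : p ≤ q → Max (L₂ p q) m → m ≈ p
  Max-L₂ˡ-unique p≤q (m∈L , maximal) = Eq.sym (maximal _ (L₂-intro refl p≤q) (L₂-≤ˡ m∈L))

  Max-L₂ʳ-unique : q ≤ p → Max (L₂ p q) m → m ≈ q
  Max-L₂ʳ-unique q≤p (m∈L , maximal) = Eq.sym (maximal _ (L₂-intro q≤p refl) (L₂-≤ʳ m∈L))

  Min-U₂ˡ : q ≤ p → Min (U₂ p q) p
  Min-U₂ˡ q≤p = U₂-intro refl q≤p , λ w w∈U w≤p → antisym w≤p (U₂-≥ˡ w∈U)

  Min-U₂ʳ : p ≤ q → Min (U₂ p q) q
  Min-U₂ʳ p≤q = U₂-intro p≤q refl , λ w w∈U w≤q → antisym w≤q (U₂-≥ʳ w∈U)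

  Min-U₂ˡ-unique : q ≤ p → Min (U₂ p q) m → m ≈ p
  Min-U₂ˡ-unique q≤p (m∈U , minimal) = Eq.sym (minimal _ (U₂-intro refl q≤p) (U₂-≥ˡ m∈U))

  Min-U₂ʳ-unique : p ≤ q → Min (U₂ p q) m → m ≈ q
  Min-U₂ʳ-unique p≤q (m∈U , minimal) = Eq.sym (minimal _ (U₂-intro p≤q refl) (U₂-≥ʳ m∈U))

  Max-L₂⇒Min-U₂′ : Max (L₂ (p ′) (q ′)) m → Min (U₂ p q) (m ′)
  Max-L₂⇒Min-U₂′ (m∈L , maximal) =
    U₂-intro (⊥⊥-sym (L₂-≤ˡ m∈L)) (⊥⊥-sym (L₂-≤ʳ m∈L)) ,
    λ w w∈U w≤m′ → Eq.trans (Eq.sym (involutive w)) (′-cong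
      (maximal (w ′) (L₂-intro (antitone (U₂-≥ˡ w∈U)) (antitone (U₂-≥ʳ w∈U))) (⊥⊥-sym w≤m′)))

  Max-L₂-exists : LubComplete → ∀ p q → Σ Carrier (Max (L₂ p q))
  Max-L₂-exists lub p q = map₂ proj₁ (lub (p ∷ q ∷ []) ⊥ (L₂-intro (⊥-min p) (⊥-min q)))

  Min-U₂-exists : LubComplete → ∀ p q → Σ Carrier (Min (U₂ p q))
  Min-U₂-exists lub p q = map _′ Max-L₂⇒Min-U₂′ (Max-L₂-exists lub (p ′) (q ′))

  IsSup-intro : p ≤ s → q ≤ s → (∀ u → p ≤ u → q ≤ u → s ≤ u) → IsSup s p q
  IsSup-intro p≤s q≤s least = lift ((p≤s , q≤s) , least)

  IsSup-≥ˡ : IsSup s p q → p ≤ s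
  IsSup-≥ˡ (lift ((p≤s , _) , _)) = p≤s

  IsSup-≥ʳ : IsSup s p q → q ≤ s
  IsSup-≥ʳ (lift ((_ , q≤s) , _)) = q≤s

  IsSup-least : IsSup s p q → ∀ u → p ≤ u → q ≤ u → s ≤ u
  IsSup-least (lift (_ , least)) = least

  IsSup-comm : IsSup s p q → IsSup s q p
  IsSup-comm s-sup = IsSup-intro (IsSup-≥ʳ s-sup) (IsSup-≥ˡ s-sup)
    (λ u q≤u p≤u → IsSup-least s-sup u p≤u q≤u)

  IsSup-resp-≈ : s ≈ s′ → p ≈ p′ → q ≈ q′ → IsSup s p q → IsSup s′ p′ q′
  IsSup-resp-≈ s≈s′ p≈p′ q≈q′ s-sup = IsSup-intro
    (≤-respˡ-≈ p≈p′ (≤-respʳ-≈ s≈s′ (IsSup-≥ˡ s-sup)))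
    (≤-respˡ-≈ q≈q′ (≤-respʳ-≈ s≈s′ (IsSup-≥ʳ s-sup)))
    (λ u p′≤u q′≤u → ≤-respˡ-≈ s≈s′
      (IsSup-least s-sup u (≤-respˡ-≈ (Eq.sym p≈p′) p′≤u) (≤-respˡ-≈ (Eq.sym q≈q′) q′≤u)))

  IsSup-of-≥ : q ≤ p → IsSup p p q
  IsSup-of-≥ q≤p = IsSup-intro refl q≤p (λ _ p≤u _ → p≤u)

  IsSup-of-≤ : p ≤ q → IsSup q p q
  IsSup-of-≤ p≤q = IsSup-intro p≤q refl (λ _ _ q≤u → q≤u)

  IsInf-intro : s ≤ p → s ≤ q → (∀ u → u ≤ p → u ≤ q → u ≤ s) → IsInf s p q
  IsInf-intro s≤p s≤q greatest = lift ((s≤p , s≤q) , greatest)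

  IsInf-≤ˡ : IsInf s p q → s ≤ p
  IsInf-≤ˡ (lift ((s≤p , _) , _)) = s≤p

  IsInf-≤ʳ : IsInf s p q → s ≤ q
  IsInf-≤ʳ (lift ((_ , s≤q) , _)) = s≤q

  IsInf-greatest : IsInf s p q → ∀ u → u ≤ p → u ≤ q → u ≤ s
  IsInf-greatest (lift (_ , greatest)) = greatest

  IsInf-unique : IsInf s p q → IsInf s′ p q → s ≈ s′
  IsInf-unique s-inf s′-inf = antisym
    (IsInf-greatest s′-inf _ (IsInf-≤ˡ s-inf) (IsInf-≤ʳ s-inf))
    (IsInf-greatest s-inf _ (IsInf-≤ˡ s′-inf) (IsInf-≤ʳ s′-inf))

  IsInf-of-≤ : p ≤ q → IsInf p p q
  IsInf-of-≤ p≤q = IsInf-intro refl p≤q (λ _ u≤p _ → u≤p)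

  IsInf-of-≥ : q ≤ p → IsInf q p q
  IsInf-of-≥ q≤p = IsInf-intro q≤p refl (λ _ _ u≤q → u≤q)

  -- p ∧ q = (p′ ∨ q′)′, and p′ ⊥ q′ because p′ ≤ q.
  IsInf-exists : Orthogonal → p ′ ≤ q → Σ Carrier λ s → IsInf s p q
  IsInf-exists {p} {q} orth p′≤q with orth (p ′) (q ′) (≤⇒⊥⊥′ p′≤q)
  ... | s , s-sup = s ′ , IsInf-intro
    (′≤-sym (IsSup-≥ˡ s-sup)) (′≤-sym (IsSup-≥ʳ s-sup))
    (λ u u≤p u≤q → ⊥⊥-sym (IsSup-least s-sup (u ′) (antitone u≤p) (antitone u≤q)))

  Max-L₂-absorbs-⊥⊥ : Orthogonal → Max (L₂ p q) b → L₂ p q e → b ⊥⊥ e → e ≤ b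
  Max-L₂-absorbs-⊥⊥ {b = b} orth (b∈L , maximal) e∈L b⊥⊥e with orth _ _ b⊥⊥e
  ... | f , f-sup = ≤-respʳ-≈ f≈b (IsSup-≥ʳ f-sup)
    where
    f≈b : f ≈ b
    f≈b = maximal f
      (L₂-intro (IsSup-least f-sup _ (L₂-≤ˡ b∈L) (L₂-≤ˡ e∈L))
                (IsSup-least f-sup _ (L₂-≤ʳ b∈L) (L₂-≤ʳ e∈L)))
      (IsSup-≥ˡ f-sup)

  record IsSup₃ (s p q r : Carrier) : Set (c ⊔ ℓ₂) where
    constructor isSup₃
    field
      p≤s : p ≤ s
      q≤s : q ≤ s
      r≤s : r ≤ s
      least : ∀ u → p ≤ u → q ≤ u → r ≤ u → s ≤ u

  IsSup-IsSup⇒IsSup₃ : IsSup d p q → IsSup s d r → IsSup₃ s p q r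
  IsSup-IsSup⇒IsSup₃ d-sup s-sup = isSup₃
    (trans (IsSup-≥ˡ d-sup) (IsSup-≥ˡ s-sup)) (trans (IsSup-≥ʳ d-sup) (IsSup-≥ˡ s-sup))
    (IsSup-≥ʳ s-sup) (λ u p≤u q≤u r≤u → IsSup-least s-sup u (IsSup-least d-sup u p≤u q≤u) r≤u)

  IsSup₃⇒IsSup : IsSup d p q → IsSup₃ s p q r → IsSup s d r
  IsSup₃⇒IsSup d-sup (isSup₃ p≤s q≤s r≤s least) =
    IsSup-intro (IsSup-least d-sup _ p≤s q≤s) r≤s
      (λ u d≤u r≤u → least u (trans (IsSup-≥ˡ d-sup) d≤u) (trans (IsSup-≥ʳ d-sup) d≤u) r≤u)

  IsSup₃-swap₁₃ : IsSup₃ s p q r → IsSup₃ s r q p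
  IsSup₃-swap₁₃ (isSup₃ p≤s q≤s r≤s least) =
    isSup₃ r≤s q≤s p≤s (λ u r≤u q≤u p≤u → least u p≤u q≤u r≤u)

  IsSup₃-swap₂₃ : IsSup₃ s p q r → IsSup₃ s p r q
  IsSup₃-swap₂₃ (isSup₃ p≤s q≤s r≤s least) =
    isSup₃ p≤s r≤s q≤s (λ u p≤u r≤u q≤u → least u p≤u q≤u r≤u)

  IsSup₃-resp-≈ : p ≈ p′ → q ≈ q′ → r ≈ r′ → IsSup₃ s p q r → IsSup₃ s p′ q′ r′
  IsSup₃-resp-≈ p≈p′ q≈q′ r≈r′ (isSup₃ p≤s q≤s r≤s least) =
    isSup₃ (≤-respˡ-≈ p≈p′ p≤s) (≤-respˡ-≈ q≈q′ q≤s) (≤-respˡ-≈ r≈r′ r≤s)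
      (λ u p′≤u q′≤u r′≤u → least u (≤-respˡ-≈ (Eq.sym p≈p′) p′≤u)
        (≤-respˡ-≈ (Eq.sym q≈q′) q′≤u) (≤-respˡ-≈ (Eq.sym r≈r′) r′≤u))

  IsSup₃-drop₃ : r ≤ q → IsSup₃ s p q r → IsSup s p q
  IsSup₃-drop₃ r≤q (isSup₃ p≤s q≤s _ least) =
    IsSup-intro p≤s q≤s (λ u p≤u q≤u → least u p≤u q≤u (trans r≤q q≤u))

  IsSup₃-≈₃ : p ≤ r → q ≤ r → IsSup₃ s p q r → s ≈ r
  IsSup₃-≈₃ p≤r q≤r (isSup₃ _ _ r≤s least) = antisym (least _ p≤r q≤r refl) r≤s

  →K-of-≤ : Orthogonal → LubComplete → x ≤ y →
    (x →K y) ≐ (λ z → Σ Carrier λ a → Σ Carrier λ d →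
                   Max (L₂ (x ′) y) a × IsSup d x (y ′) × IsSup z d a)
  →K-of-≤ {x} {y} orth lub x≤y = to , from
    where
    x≤U : U₂ (x ′) y r → x ≤ r
    x≤U r∈U = trans x≤y (U₂-≥ʳ r∈U)

    to : (x →K y) z → Σ Carrier λ a → Σ Carrier λ d →
             Max (L₂ (x ′) y) a × IsSup d x (y ′) × IsSup z d a
    to (a , b , r , d , e , a∈Max , b∈Max , r∈Min , a∨b , x∧r , d∨e)
      with orth x (y ′) (≤⇒⊥⊥′ x≤y)
    ... | d′ , x∨y′ = a , d′ , a∈Max , x∨y′ , IsSup₃⇒IsSup x∨y′ (IsSup₃-swap₁₃
          (IsSup₃-resp-≈ Eq.refl b≈y′ e≈x (IsSup-IsSup⇒IsSup₃ a∨b d∨e)))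
      where
      b≈y′ : b ≈ y ′
      b≈y′ = Max-L₂ʳ-unique (antitone x≤y) b∈Max
      e≈x : e ≈ x
      e≈x = IsInf-unique x∧r (IsInf-of-≤ (x≤U (proj₁ r∈Min)))

    from : (Σ Carrier λ a → Σ Carrier λ d →
             Max (L₂ (x ′) y) a × IsSup d x (y ′) × IsSup z d a) →
           (x →K y) z
    from (a , d′ , a∈Max , x∨y′ , d′∨a)
      with Min-U₂-exists lub (x ′) y | orth a (y ′) (≤⇒⊥⊥′ (L₂-≤ʳ (proj₁ a∈Max)))
    ... | r , r∈Min | d , a∨y′ =
      a , y ′ , r , d , x , a∈Max , Max-L₂ʳ (antitone x≤y) , r∈Min , a∨y′ ,
      IsInf-of-≤ (x≤U (proj₁ r∈Min)) ,
      IsSup₃⇒IsSup a∨y′ (IsSup₃-swap₁₃ (IsSup-IsSup⇒IsSup₃ x∨y′ d′∨a))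

  →K-of-⊥⊥ : Orthogonal → x ⊥⊥ y →
    (x →K y) ≐ (λ z → Σ Carrier λ b → Max (L₂ (x ′) (y ′)) b × IsSup z y b)
  →K-of-⊥⊥ {x} {y} orth x⊥⊥y = to , from
    where
    y≤x′ : y ≤ x ′
    y≤x′ = ⊥⊥-sym x⊥⊥y

    below-x-x′≤b : e ≤ x → e ≤ x ′ → Max (L₂ (x ′) (y ′)) b → e ≤ b
    below-x-x′≤b e≤x e≤x′ b∈Max = Max-L₂-absorbs-⊥⊥ orth b∈Max
      (L₂-intro e≤x′ (trans e≤x x⊥⊥y)) (trans (L₂-≤ˡ (proj₁ b∈Max)) (antitone e≤x))

    to : (x →K y) z → Σ Carrier λ b → Max (L₂ (x ′) (y ′)) b × IsSup z y b
    to (a , b , r , d , e , a∈Max , b∈Max , r∈Min , a∨b , x∧r , d∨e) =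
      b , b∈Max , IsSup-resp-≈ Eq.refl (Max-L₂ʳ-unique y≤x′ a∈Max) Eq.refl
        (IsSup₃-drop₃ e≤b (IsSup-IsSup⇒IsSup₃ a∨b d∨e))
      where
      e≤x′ : e ≤ x ′
      e≤x′ = ≤-respʳ-≈ (Min-U₂ˡ-unique y≤x′ r∈Min) (IsInf-≤ʳ x∧r)
      e≤b : e ≤ b
      e≤b = below-x-x′≤b (IsInf-≤ˡ x∧r) e≤x′ b∈Max

    from : (Σ Carrier λ b → Max (L₂ (x ′) (y ′)) b × IsSup z y b) → (x →K y) z
    from {z} (b , b∈Max , y∨b) with IsInf-exists orth refl
    ... | e , x∧x′ =
      y , b , x ′ , z , e , Max-L₂ʳ y≤x′ , b∈Max , Min-U₂ˡ y≤x′ , y∨b , x∧x′ ,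
      IsSup-of-≥ (trans (below-x-x′≤b (IsInf-≤ˡ x∧x′) (IsInf-≤ʳ x∧x′) b∈Max) (IsSup-≥ʳ y∨b))

  →K-of-≥ : LubComplete → y ≤ x →
    (x →K y) ≐ (λ z → Σ Carrier λ c → Σ Carrier λ e →
                   Min (U₂ (x ′) y) c × IsInf e x c × IsSup z (x ′) e)
  →K-of-≥ {y} {x} lub y≤x = to , from
    where
    x′≤y′ : x ′ ≤ y ′
    x′≤y′ = antitone y≤x

    to : (x →K y) z → Σ Carrier λ c → Σ Carrier λ e →
             Min (U₂ (x ′) y) c × IsInf e x c × IsSup z (x ′) e
    to (a , b , r , d , e , a∈Max , b∈Max , r∈Min , a∨b , x∧r , d∨e) =
      r , e , r∈Min , x∧r , IsSup-comm (IsSup₃-drop₃ (L₂-≤ˡ (proj₁ a∈Max)) (IsSup₃-swap₁₃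
        (IsSup₃-resp-≈ Eq.refl (Max-L₂ˡ-unique x′≤y′ b∈Max) Eq.refl (IsSup-IsSup⇒IsSup₃ a∨b d∨e))))

    from : (Σ Carrier λ c → Σ Carrier λ e →
             Min (U₂ (x ′) y) c × IsInf e x c × IsSup z (x ′) e) →
           (x →K y) z
    from (r , e , r∈Min , x∧r , x′∨e) with Max-L₂-exists lub (x ′) y
    ... | a , a∈Max = a , x ′ , r , x ′ , e , a∈Max , Max-L₂ˡ x′≤y′ , r∈Min ,
                      IsSup-of-≤ (L₂-≤ˡ (proj₁ a∈Max)) , x∧r , x′∨e

  →K-⊤ : ∀ x → (x →K ⊤) ≐ (λ z → IsSup z x (x ′))
  →K-⊤ x = to , from
    where
    to : (x →K ⊤) z → IsSup z x (x ′)
    to (a , b , r , d , e , a∈Max , b∈Max , r∈Min , a∨b , x∧r , d∨e) =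
      IsSup-comm (IsSup-resp-≈ Eq.refl (Max-L₂ˡ-unique (⊤-max _) a∈Max) e≈x
        (IsSup₃-drop₃ (trans (L₂-≤ʳ (proj₁ b∈Max)) (⊤′-min e))
          (IsSup₃-swap₂₃ (IsSup-IsSup⇒IsSup₃ a∨b d∨e))))
      where
      e≈x : e ≈ x
      e≈x = IsInf-unique x∧r (IsInf-of-≤ (trans (⊤-max x) (U₂-≥ʳ (proj₁ r∈Min))))

    from : IsSup z x (x ′) → (x →K ⊤) z
    from x∨x′ = x ′ , ⊤ ′ , ⊤ , x ′ , x , Max-L₂ˡ (⊤-max _) , Max-L₂ʳ (⊤′-min _) ,
      Min-U₂ʳ (⊤-max _) , IsSup-of-≥ (⊤′-min _) , IsInf-of-≤ (⊤-max x) , IsSup-comm x∨x′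

  ⊤-→K : ∀ x → (⊤ →K x) ≐ ⟦ x ⟧
  ⊤-→K x = to , from
    where
    to : (⊤ →K x) z → ⟦ x ⟧ z
    to (a , b , r , d , e , a∈Max , b∈Max , r∈Min , a∨b , ⊤∧r , d∨e) = lift (Eq.trans
      (IsSup₃-≈₃ (trans (L₂-≤ˡ (proj₁ a∈Max)) (⊤′-min e)) (trans (L₂-≤ˡ (proj₁ b∈Max)) (⊤′-min e))
        (IsSup-IsSup⇒IsSup₃ a∨b d∨e))
      (Eq.trans (IsInf-unique ⊤∧r (IsInf-of-≥ (⊤-max r))) (Min-U₂ʳ-unique (⊤′-min x) r∈Min)))

    from : ⟦ x ⟧ z → (⊤ →K x) z
    from (lift z≈x) = ⊤ ′ , ⊤ ′ , x , ⊤ ′ , x , Max-L₂ˡ (⊤′-min x) , Max-L₂ˡ (⊤′-min (x ′)) ,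
      Min-U₂ʳ (⊤′-min x) , IsSup-of-≥ refl , IsInf-of-≥ (⊤-max x) ,
      IsSup-resp-≈ (Eq.sym z≈x) Eq.refl Eq.refl (IsSup-of-≤ (⊤′-min x))

  →K-⊥ : Orthogonal → ∀ x → (x →K ⊥) ≐ ⟦ x ′ ⟧
  →K-⊥ orth x = to , from
    where
    to : (x →K ⊥) z → ⟦ x ′ ⟧ z
    to (a , b , r , d , e , a∈Max , b∈Max , r∈Min , a∨b , x∧r , d∨e) =
      lift (Eq.trans (IsSup₃-≈₃ a≤b e≤b (IsSup₃-swap₂₃ (IsSup-IsSup⇒IsSup₃ a∨b d∨e))) b≈x′)
      where
      b≈x′ : b ≈ x ′
      b≈x′ = Max-L₂ˡ-unique (⊥′-max (x ′)) b∈Max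
      a≤b : a ≤ b
      a≤b = trans (L₂-≤ʳ (proj₁ a∈Max)) (⊥-min b)
      e≤b : e ≤ b
      e≤b = ≤-respʳ-≈ (Eq.sym b≈x′) (≤-respʳ-≈ (Min-U₂ˡ-unique (⊥-min _) r∈Min) (IsInf-≤ʳ x∧r))

    from : ⟦ x ′ ⟧ z → (x →K ⊥) z
    from (lift z≈x′) with IsInf-exists orth refl
    ... | e , x∧x′ = ⊥ , x ′ , x ′ , x ′ , e , Max-L₂ʳ (⊥-min _) , Max-L₂ˡ (⊥′-max _) ,
      Min-U₂ˡ (⊥-min _) , IsSup-of-≤ (⊥-min _) , x∧x′ ,
      IsSup-resp-≈ (Eq.sym z≈x′) Eq.refl Eq.refl (IsSup-of-≥ (IsInf-≤ʳ x∧x′))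

  ⊥-→K : ∀ x → (⊥ →K x) ≐ (λ z → IsSup z x (x ′))
  ⊥-→K x = to , from
    where
    to : (⊥ →K x) z → IsSup z x (x ′)
    to (a , b , r , d , e , a∈Max , b∈Max , r∈Min , a∨b , ⊥∧r , d∨e) =
      IsSup-resp-≈ Eq.refl (Max-L₂ʳ-unique (⊥′-max x) a∈Max) (Max-L₂ʳ-unique (⊥′-max (x ′)) b∈Max)
        (IsSup₃-drop₃ (trans (IsInf-≤ˡ ⊥∧r) (⊥-min b)) (IsSup-IsSup⇒IsSup₃ a∨b d∨e))

    from : IsSup z x (x ′) → (⊥ →K x) z
    from {z} x∨x′ = x , x ′ , ⊥ ′ , z , ⊥ , Max-L₂ʳ (⊥′-max x) , Max-L₂ʳ (⊥′-max _) ,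
      Min-U₂ˡ (⊥′-max x) , x∨x′ , IsInf-of-≤ (⊥-min _) , IsSup-of-≥ (⊥-min z)

proposition4 : {c ℓ₁ ℓ₂ : Level} (P : BoundedPosetInv c ℓ₁ ℓ₂) →
    let open BoundedPosetInv P
        open Ops P
    in Orthogonal → LubComplete → ∀ x y →
      ((x ≤ y → (x →K y) ≐ (λ z → Σ Carrier λ a → Σ Carrier λ d →
                   Max (L₂ (x ′) y) a × IsSup d x (y ′) × IsSup z d a))
       × (x ⊥⊥ y → (x →K y) ≐ (λ z → Σ Carrier λ b →
                   Max (L₂ (x ′) (y ′)) b × IsSup z y b))
       × (y ≤ x → (x →K y) ≐ (λ z → Σ Carrier λ c → Σ Carrier λ e →
                   Min (U₂ (x ′) y) c × IsInf e x c × IsSup z (x ′) e)))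
      × (((x →K ⊤) ≐ (λ z → IsSup z x (x ′))) × ((⊤ →K x) ≐ ⟦ x ⟧))
      × (((x →K ⊥) ≐ ⟦ x ′ ⟧) × ((⊥ →K x) ≐ (λ z → IsSup z x (x ′))))
proposition4 P orth lub x y =
  (→K-of-≤ orth lub , →K-of-⊥⊥ orth , →K-of-≥ lub) ,
  (→K-⊤ x , ⊤-→K x) ,
  (→K-⊥ orth x , ⊥-→K x)
  where open Kalmbach P
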